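{- For all $u,v,y\in\mathbb{YF}$ with $y\geqslant u$ and $y\geqslant v$, we have $y\geqslant o(u,v)$.
   Context: $\mathbb{YF}$ is the set of all finite words (including the empty word $\varepsilon$) over $\{1,2\}$. For a word $v$, $\#v$ is its length and $d(v)$ the number of letters $2$. Order: write $x=x'w$, $y=y'w$ with $w$ the longest common suffix; then $y\geqslant x$ iff $d(y')\geqslant\#x'$. The vertex $o(u,v)$ is defined as follows: write $u=u'w$, $v=v'w$ where $w$ is the longest common suffix of $u$ and $v$. Assume $\#u\geqslant\#v$ (otherwise exchange the roles of $u$ and $v$). Then $o(u,v)$ is obtained from $u$ by replacing the first (leftmost) $\max(\#v'-d(u'),0)$ letters $1$ by $2$. (The result has the form $2^xu''w$ with $x+\#u''+\#w=\#u$ and $x+d(u'')\geqslant\#v'$; the definition is correct and $o(u,v)\geqslant u$, $o(u,v)\geqslant v$.) -}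

module Defs where

open import Data.Nat using (ℕ; zero; suc; _∸_; _≤_; _≤?_)
open import Data.List using (List; []; _∷_; length; reverse)
open import Data.Product using (_×_; _,_)
open import Relation.Nullary using (yes; no)

data Letter : Set where
  one two : Letter

YF : Set
YF = List Letter

#_ : YF → ℕ
# v = length v

d : YF → ℕ
d [] = zero
d (one ∷ v) = d v
d (two ∷ v) = suc (d v)

dropCommonPrefix : YF → YF → YF × YF
dropCommonPrefix (one ∷ x) (one ∷ y) = dropCommonPrefix x y
dropCommonPrefix (two ∷ x) (two ∷ y) = dropCommonPrefix x y
dropCommonPrefix x y = x , y

-- strip x y = (x' , y') where x = x' w, y = y' w, w the longest common suffix
strip : YF → YF → YF × YF
strip x y with dropCommonPrefix (reverse x) (reverse y)
... | rx , ry = reverse rx , reverse ry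

_≥YF_ : YF → YF → Set
y ≥YF x with strip x y
... | x' , y' = # x' ≤ d y'

replaceOnes : ℕ → YF → YF
replaceOnes zero u = u
replaceOnes (suc k) [] = []
replaceOnes (suc k) (one ∷ u) = two ∷ replaceOnes k u
replaceOnes (suc k) (two ∷ u) = two ∷ replaceOnes (suc k) u

oLong : YF → YF → YF
oLong u v with strip u v
... | u' , v' = replaceOnes (# v' ∸ d u') u

o : YF → YF → YF
o u v with # v ≤? # u
... | yes _ = oLong u v
... | no _ = oLong v u

-- The relation y ≥ x holds as soon as SOME common suffix w splits x = x₀w, y = y₀w with
-- #x₀ ≤ d(y₀): enlarging the common suffix by a word c costs #c on the left and only
-- d(c) ≤ #c on the right, so the longest common suffix is the best one.  With u = u′t,
-- v = v′t split along their longest common suffix t, we have o(u,v) = r t where r is u′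
-- with its first k = #v′ − d(u′) letters 1 turned into 2.  A witness for y ≥ u either
-- has a head containing u′, and then the same split works for r t, or it cuts u′ = u₁s.
-- In the latter case the witness for y ≥ v gives #v′ ≤ d(y₁s), because u′ and v′ have
-- no common nonempty suffix, and this budget pays for the k new letters 2.
module Submission where

open import Defs
open import Data.Nat using (ℕ; zero; suc; _+_; _∸_; _≤_; _≤?_; s≤s)
open import Data.Nat.Properties
open import Data.List using (List; []; _∷_; [_]; _++_; _∷ʳ_; length; reverse)
open import Data.List.Properties
  using (++-assoc; ++-identityʳ; ++-identityʳ-unique; ++-conicalˡ; ++-cancelʳ; ∷-injectiveˡ; ∷-injectiveʳ;
         ∷ʳ-++; length-++; reverse-++; reverse-involutive)
open import Data.Product using (∃; _×_; _,_; proj₁; proj₂)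
open import Data.Sum using (_⊎_; inj₁; inj₂)
open import Relation.Nullary using (yes; no)
open import Relation.Binary.PropositionalEquality hiding ([_])

ones : YF → ℕ
ones []        = 0
ones (one ∷ v) = suc (ones v)
ones (two ∷ v) = ones v

length≡d+ones : ∀ x → # x ≡ d x + ones x
length≡d+ones []        = refl
length≡d+ones (one ∷ x) = trans (cong suc (length≡d+ones x)) (sym (+-suc (d x) (ones x)))
length≡d+ones (two ∷ x) = cong suc (length≡d+ones x)

d≤length : ∀ x → d x ≤ # x
d≤length x = subst (d x ≤_) (sym (length≡d+ones x)) (m≤m+n (d x) (ones x))

ones≡length∸d : ∀ x → ones x ≡ # x ∸ d x
ones≡length∸d x = sym (trans (cong (_∸ d x) (length≡d+ones x)) (m+n∸m≡n (d x) (ones x)))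

d-++ : ∀ a b → d (a ++ b) ≡ d a + d b
d-++ []        b = refl
d-++ (one ∷ a) b = d-++ a b
d-++ (two ∷ a) b = cong suc (d-++ a b)

length-∷ʳ : ∀ (x : YF) {a} → # (x ∷ʳ a) ≡ suc (# x)
length-∷ʳ x = trans (length-++ x) (+-comm (# x) 1)

length≤d-cancelʳ : ∀ a b c → # (a ++ c) ≤ d (b ++ c) → # a ≤ d b
length≤d-cancelʳ a b c le = +-cancelʳ-≤ (# c) (# a) (d b) (begin
  # a + # c    ≡⟨ length-++ a ⟨
  # (a ++ c)   ≤⟨ le ⟩
  d (b ++ c)   ≡⟨ d-++ b c ⟩
  d b + d c    ≤⟨ +-monoʳ-≤ (d b) (d≤length c) ⟩
  d b + # c    ∎)
  where open ≤-Reasoning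

length-replaceOnes : ∀ k x → # replaceOnes k x ≡ # x
length-replaceOnes zero    x         = refl
length-replaceOnes (suc k) []        = refl
length-replaceOnes (suc k) (one ∷ x) = cong suc (length-replaceOnes k x)
length-replaceOnes (suc k) (two ∷ x) = cong suc (length-replaceOnes (suc k) x)

replaceOnes-++ : ∀ k a b → replaceOnes k (a ++ b) ≡ replaceOnes k a ++ replaceOnes (k ∸ ones a) b
replaceOnes-++ zero    a b rewrite 0∸n≡0 (ones a) = refl
replaceOnes-++ (suc k) []        b = refl
replaceOnes-++ (suc k) (one ∷ a) b = cong (two ∷_) (replaceOnes-++ k a b)
replaceOnes-++ (suc k) (two ∷ a) b = cong (two ∷_) (replaceOnes-++ (suc k) a b)

replaceOnes-++-≤ones : ∀ {k} a b → k ≤ ones a → replaceOnes k (a ++ b) ≡ replaceOnes k a ++ b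
replaceOnes-++-≤ones {k} a b k≤ rewrite replaceOnes-++ k a b | m≤n⇒m∸n≡0 k≤ = refl

++-split : ∀ (a w b z : YF) → a ++ w ≡ b ++ z →
  (∃ λ c → b ≡ a ++ c × w ≡ c ++ z) ⊎ (∃ λ c → a ≡ b ++ c × z ≡ c ++ w)
++-split []      w b       z eq = inj₁ (b , refl , eq)
++-split (x ∷ a) w []      z eq = inj₂ (x ∷ a , refl , sym eq)
++-split (x ∷ a) w (y ∷ b) z eq with ∷-injectiveˡ eq | ++-split a w b z (∷-injectiveʳ eq)
... | refl | inj₁ (c , e₁ , e₂) = inj₁ (c , cong (x ∷_) e₁ , e₂)
... | refl | inj₂ (c , e₁ , e₂) = inj₂ (c , cong (x ∷_) e₁ , e₂)

dropCommonPrefix-++ : ∀ X Y →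
  ∃ λ p → X ≡ p ++ proj₁ (dropCommonPrefix X Y) × Y ≡ p ++ proj₂ (dropCommonPrefix X Y)
dropCommonPrefix-++ (one ∷ x) (one ∷ y) with dropCommonPrefix-++ x y
... | p , e₁ , e₂ = one ∷ p , cong (one ∷_) e₁ , cong (one ∷_) e₂
dropCommonPrefix-++ (two ∷ x) (two ∷ y) with dropCommonPrefix-++ x y
... | p , e₁ , e₂ = two ∷ p , cong (two ∷_) e₁ , cong (two ∷_) e₂
dropCommonPrefix-++ []        y         = [] , refl , refl
dropCommonPrefix-++ (one ∷ x) []        = [] , refl , refl
dropCommonPrefix-++ (one ∷ x) (two ∷ y) = [] , refl , refl
dropCommonPrefix-++ (two ∷ x) []        = [] , refl , refl
dropCommonPrefix-++ (two ∷ x) (one ∷ y) = [] , refl , refl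

dropCommonPrefix-longest : ∀ p A B →
  ∃ λ c → A ≡ c ++ proj₁ (dropCommonPrefix (p ++ A) (p ++ B))
        × B ≡ c ++ proj₂ (dropCommonPrefix (p ++ A) (p ++ B))
dropCommonPrefix-longest []        A B = dropCommonPrefix-++ A B
dropCommonPrefix-longest (one ∷ p) A B = dropCommonPrefix-longest p A B
dropCommonPrefix-longest (two ∷ p) A B = dropCommonPrefix-longest p A B

reverse-≡-++ : ∀ (a c X : YF) → reverse a ≡ c ++ X → a ≡ reverse X ++ reverse c
reverse-≡-++ a c X eq = trans (sym (reverse-involutive a)) (trans (cong reverse eq) (reverse-++ c X))

strip-++ : ∀ x y → ∃ λ w → x ≡ proj₁ (strip x y) ++ w × y ≡ proj₂ (strip x y) ++ w
strip-++ x y with dropCommonPrefix-++ (reverse x) (reverse y)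
... | p , e₁ , e₂ = reverse p , reverse-≡-++ x p _ e₁ , reverse-≡-++ y p _ e₂

strip-longest : ∀ a b w →
  ∃ λ c → a ≡ proj₁ (strip (a ++ w) (b ++ w)) ++ c × b ≡ proj₂ (strip (a ++ w) (b ++ w)) ++ c
strip-longest a b w rewrite reverse-++ a w | reverse-++ b w
  with dropCommonPrefix-longest (reverse w) (reverse a) (reverse b)
... | c , e₁ , e₂ = reverse c , reverse-≡-++ a c _ e₁ , reverse-≡-++ b c _ e₂

NoCommonSuffix : YF → YF → Set
NoCommonSuffix x y = ∀ {a b e} → x ≡ a ++ e → y ≡ b ++ e → e ≡ []

strip-noCommonSuffix : ∀ x y → NoCommonSuffix (proj₁ (strip x y)) (proj₂ (strip x y))
strip-noCommonSuffix x y {a} {b} {e} ex ey with strip-++ x y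
... | w , x≡ , y≡ with strip-longest a b (e ++ w)
... | c , a≡ , _ = ++-conicalˡ e c (++-identityʳ-unique a (begin
  a                                                 ≡⟨ a≡ ⟩
  proj₁ (strip (a ++ e ++ w) (b ++ e ++ w)) ++ c    ≡⟨ cong (λ z → proj₁ z ++ c) (cong₂ strip x≡′ y≡′) ⟨
  proj₁ (strip x y) ++ c                            ≡⟨ cong (_++ c) ex ⟩
  (a ++ e) ++ c                                     ≡⟨ ++-assoc a e c ⟩
  a ++ e ++ c                                       ∎))
  where
  open ≡-Reasoning
  x≡′ : x ≡ a ++ e ++ w
  x≡′ = trans x≡ (trans (cong (_++ w) ex) (++-assoc a e w))
  y≡′ : y ≡ b ++ e ++ w
  y≡′ = trans y≡ (trans (cong (_++ w) ey) (++-assoc b e w))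

data _≽_ (y x : YF) : Set where
  split : ∀ x₀ y₀ w → x ≡ x₀ ++ w → y ≡ y₀ ++ w → # x₀ ≤ d y₀ → y ≽ x

≥YF⇒≽ : ∀ {x y} → y ≥YF x → y ≽ x
≥YF⇒≽ {x} {y} y≥x with strip-++ x y
... | w , x≡ , y≡ = split _ _ w x≡ y≡ y≥x

≽⇒≥YF : ∀ {x y} → y ≽ x → y ≥YF x
≽⇒≥YF (split x₀ y₀ w refl refl le) with strip-longest x₀ y₀ w
... | c , x₀≡ , y₀≡ =
  length≤d-cancelʳ (proj₁ (strip (x₀ ++ w) (y₀ ++ w))) (proj₂ (strip (x₀ ++ w) (y₀ ++ w))) c
    (subst₂ (λ a b → # a ≤ d b) x₀≡ y₀≡ le)

≽-++ʳ : ∀ {x y} t → y ≽ x → (y ++ t) ≽ (x ++ t)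
≽-++ʳ t (split x₀ y₀ w refl refl le) = split x₀ y₀ (w ++ t) (++-assoc x₀ w t) (++-assoc y₀ w t) le

≽-++-replaceOnes : ∀ {r y₀} j s → # r + j ≤ d y₀ → (y₀ ++ s) ≽ (r ++ replaceOnes j s)
≽-++-replaceOnes {r} {y₀} zero    s         le = split r y₀ s refl refl (≤-trans (m≤m+n (# r) 0) le)
≽-++-replaceOnes {r} {y₀} (suc j) []        le = split r y₀ [] refl refl (≤-trans (m≤m+n (# r) _) le)
≽-++-replaceOnes {r} {y₀} (suc j) (one ∷ s) le =
  subst₂ _≽_ (∷ʳ-++ y₀ one s) (∷ʳ-++ r two _)
    (≽-++-replaceOnes j s (subst₂ _≤_ (cong (_+ j) (sym (length-∷ʳ r))) (sym (d-∷ʳ-one y₀))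
      (subst (_≤ d y₀) (+-suc (# r) j) le)))
  where
  d-∷ʳ-one : ∀ y → d (y ∷ʳ one) ≡ d y
  d-∷ʳ-one y = trans (d-++ y [ one ]) (+-identityʳ (d y))
≽-++-replaceOnes {r} {y₀} (suc j) (two ∷ s) le =
  subst₂ _≽_ (∷ʳ-++ y₀ two s) (∷ʳ-++ r two _)
    (≽-++-replaceOnes (suc j) s (subst₂ _≤_ (cong (_+ suc j) (sym (length-∷ʳ r))) (sym (d-∷ʳ-two y₀))
      (s≤s le)))
  where
  d-∷ʳ-two : ∀ y → d (y ∷ʳ two) ≡ suc (d y)
  d-∷ʳ-two y = trans (d-++ y [ two ]) (+-comm (d y) 1)

n+[v∸[e+n]]≤y : ∀ {n y e v} → n ≤ y → v ≤ y + e → n + (v ∸ (e + n)) ≤ y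
n+[v∸[e+n]]≤y {n} {y} {e} {v} n≤y v≤y+e = begin
  n + (v ∸ (e + n))        ≤⟨ +-monoʳ-≤ n (∸-monoˡ-≤ (e + n) v≤y+e) ⟩
  n + ((y + e) ∸ (e + n))  ≡⟨ cong (λ z → n + (z ∸ (e + n))) (+-comm y e) ⟩
  n + ((e + y) ∸ (e + n))  ≡⟨ cong (n +_) ([m+n]∸[m+o]≡n∸o e y n) ⟩
  n + (y ∸ n)              ≡⟨ m+[n∸m]≡n n≤y ⟩
  y                        ∎
  where open ≤-Reasoning

≽-replaceOnes : ∀ {u₁ y₁} v s → # u₁ ≤ d y₁ → v ≤ d (y₁ ++ s) →
  (y₁ ++ s) ≽ replaceOnes (v ∸ d (u₁ ++ s)) (u₁ ++ s)
≽-replaceOnes {u₁} {y₁} v s u₁≤y₁ v≤y₁s =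
  subst ((y₁ ++ s) ≽_) (sym (replaceOnes-++ k u₁ s)) (≽-++-replaceOnes (k ∸ ones u₁) s (begin
    # replaceOnes k u₁ + (k ∸ ones u₁)  ≡⟨ cong₂ _+_ (length-replaceOnes k u₁) k∸ones≡ ⟩
    # u₁ + (v ∸ (d s + # u₁))          ≤⟨ n+[v∸[e+n]]≤y u₁≤y₁ (subst (v ≤_) (d-++ y₁ s) v≤y₁s) ⟩
    d y₁                               ∎))
  where
  open ≤-Reasoning
  k = v ∸ d (u₁ ++ s)
  k∸ones≡ : k ∸ ones u₁ ≡ v ∸ (d s + # u₁)
  k∸ones≡ = trans (∸-+-assoc v (d (u₁ ++ s)) (ones u₁)) (cong (v ∸_) (begin-equality
    d (u₁ ++ s) + ones u₁    ≡⟨ cong (_+ ones u₁) (trans (d-++ u₁ s) (+-comm (d u₁) (d s))) ⟩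
    (d s + d u₁) + ones u₁   ≡⟨ +-assoc (d s) (d u₁) (ones u₁) ⟩
    d s + (d u₁ + ones u₁)   ≡⟨ cong (d s +_) (length≡d+ones u₁) ⟨
    d s + # u₁               ∎))

length≤d-head : ∀ {u₁ s v′ t y₁} → NoCommonSuffix (u₁ ++ s) v′ → # v′ ≤ # (u₁ ++ s) → # u₁ ≤ d y₁ →
  (y₁ ++ s ++ t) ≽ (v′ ++ t) → # v′ ≤ d (y₁ ++ s)
length≤d-head {u₁} {s} {v′} {t} {y₁} apart v′≤u′ u₁≤y₁ (split v₂ y₂ w₂ ev ey v₂≤y₂)
  with ++-split v′ t v₂ w₂ ev
... | inj₁ (e , refl , refl) = length≤d-cancelʳ v′ (y₁ ++ s) e (subst (λ z → # (v′ ++ e) ≤ d z) y₂≡ v₂≤y₂)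
  where
  y₂≡ : y₂ ≡ (y₁ ++ s) ++ e
  y₂≡ = ++-cancelʳ w₂ y₂ _ (trans (sym ey) (sym (trans (++-assoc (y₁ ++ s) e w₂) (++-assoc y₁ s (e ++ w₂)))))
... | inj₂ (e , refl , refl)
  with ++-split y₁ s y₂ e (++-cancelʳ t _ _ (trans (++-assoc y₁ s t) (trans ey (sym (++-assoc y₂ e t)))))
...   | inj₁ (f , refl , refl) with apart {e = e} (sym (++-assoc u₁ f e)) refl
...     | refl rewrite ++-identityʳ v₂ | ++-identityʳ f = v₂≤y₂
length≤d-head {u₁} {s} apart v′≤u′ u₁≤y₁ (split v₂ y₂ _ _ _ _)
  | inj₂ (_ , refl , refl) | inj₂ (f , refl , refl) with apart {e = s} refl (sym (++-assoc v₂ f s))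
...     | refl rewrite ++-identityʳ u₁ | ++-identityʳ (y₂ ++ f) = ≤-trans v′≤u′ u₁≤y₁

replaceOnes-upper : ∀ {u′ v′ t y} → NoCommonSuffix u′ v′ → # v′ ≤ # u′ →
  y ≽ (u′ ++ t) → y ≽ (v′ ++ t) → y ≽ (replaceOnes (# v′ ∸ d u′) u′ ++ t)
replaceOnes-upper {u′} {v′} {t} apart v′≤u′ (split u₁ y₁ w₁ eu refl u₁≤y₁) y≽v with ++-split u′ t u₁ w₁ eu
... | inj₁ (c , refl , refl) =
  split (replaceOnes k u′ ++ c) y₁ w₁ (sym (++-assoc _ c w₁)) refl (subst (_≤ d y₁) length≡ u₁≤y₁)
  where
  k = # v′ ∸ d u′
  length≡ : # (u′ ++ c) ≡ # (replaceOnes k u′ ++ c)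
  length≡ = begin
    # (u′ ++ c)                 ≡⟨ length-++ u′ ⟩
    # u′ + # c                  ≡⟨ cong (_+ # c) (length-replaceOnes k u′) ⟨
    # replaceOnes k u′ + # c    ≡⟨ length-++ (replaceOnes k u′) ⟨
    # (replaceOnes k u′ ++ c)   ∎
    where open ≡-Reasoning
... | inj₂ (s , refl , refl) =
  subst (_≽ _) (++-assoc y₁ s t)
    (≽-++ʳ t (≽-replaceOnes {u₁} (# v′) s u₁≤y₁ (length≤d-head {u₁} {s} {y₁ = y₁} apart v′≤u′ u₁≤y₁ y≽v)))

oLong-upper : ∀ u v y → # v ≤ # u → y ≥YF u → y ≥YF v → y ≥YF oLong u v
oLong-upper u v y v≤u y≥u y≥v with strip-++ u v
... | t , u≡ , v≡ = ≽⇒≥YF (subst (y ≽_) o≡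
      (replaceOnes-upper (strip-noCommonSuffix u v) v′≤u′
        (subst (y ≽_) u≡ (≥YF⇒≽ y≥u)) (subst (y ≽_) v≡ (≥YF⇒≽ y≥v))))
  where
  u′ = proj₁ (strip u v)
  v′ = proj₂ (strip u v)
  v′≤u′ : # v′ ≤ # u′
  v′≤u′ = +-cancelʳ-≤ (# t) (# v′) (# u′)
    (subst₂ _≤_ (trans (cong length v≡) (length-++ v′)) (trans (cong length u≡) (length-++ u′)) v≤u)
  k≤ones : # v′ ∸ d u′ ≤ ones u′
  k≤ones = subst (# v′ ∸ d u′ ≤_) (sym (ones≡length∸d u′)) (∸-monoˡ-≤ (d u′) v′≤u′)
  o≡ : replaceOnes (# v′ ∸ d u′) u′ ++ t ≡ replaceOnes (# v′ ∸ d u′) u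
  o≡ = trans (sym (replaceOnes-++-≤ones u′ t k≤ones)) (cong (replaceOnes (# v′ ∸ d u′)) (sym u≡))

mainTheorem4 : (u v y : YF) → y ≥YF u → y ≥YF v → y ≥YF o u v
mainTheorem4 u v y y≥u y≥v with # v ≤? # u
... | yes v≤u = oLong-upper u v y v≤u y≥u y≥v
... | no v≰u  = oLong-upper v u y (≰⇒≥ v≰u) y≥v y≥u
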